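{- Let $(P,\mathcal{L})$ be an $r$-uniform linear system with $\nu_2(P,\mathcal{L})-1\leq r$ and $\tau(P,\mathcal{L})=\lceil \nu_2(P,\mathcal{L})/2\rceil$. Then $$\tau(P,\mathcal{L})\leq \frac{|P|+|\mathcal{L}|}{r+1}.$$
   Context: A linear system is a pair $(P,\mathcal{L})$ where $P$ is a finite set (points) and $\mathcal{L}$ is a family of subsets of $P$ (lines) such that $|l\cap l'|\leq 1$ for all distinct $l,l'\in\mathcal{L}$; it is $r$-uniform if every line has exactly $r$ points. A transversal is a set $T\subseteq P$ meeting every line; $\tau(P,\mathcal{L})$ is the minimum size of a transversal. A 2-packing is a set $R\subseteq\mathcal{L}$ such that no three lines of $R$ have a common point; $\nu_2(P,\mathcal{L})$ is the maximum size of a 2-packing. -}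

module Defs where

open import Data.Nat using (ℕ; _≤_; _≥_)
open import Data.Fin using (Fin)
open import Data.Fin.Subset using (Subset; _∈_; _∩_; ∣_∣)
open import Data.Product using (_×_; ∃; Σ)
open import Relation.Nullary using (¬_)
open import Relation.Binary.PropositionalEquality using (_≡_; _≢_)
open import Function.Definitions using (Injective)

-- A linear system with point set Fin n and m lines; lines are given by an
-- injective family Fin m → Subset n (so the lines form a set of m subsets).
record LinearSystem (n m : ℕ) : Set where
  field
    line     : Fin m → Subset n
    distinct : Injective _≡_ _≡_ line
    linear   : ∀ (j k : Fin m) → j ≢ k → ∣ line j ∩ line k ∣ ≤ 1
open LinearSystem public

Uniform : ∀ {n m} → LinearSystem n m → ℕ → Set
Uniform S r = ∀ j → ∣ line S j ∣ ≡ r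

IsTransversal : ∀ {n m} → LinearSystem n m → Subset n → Set
IsTransversal {n} {m} S T = ∀ (j : Fin m) → ∃ λ (p : Fin n) → p ∈ T × p ∈ line S j

IsTau : ∀ {n m} → LinearSystem n m → ℕ → Set
IsTau {n} S t =
  (Σ (Subset n) λ T → IsTransversal S T × ∣ T ∣ ≡ t) ×
  (∀ (T : Subset n) → IsTransversal S T → t ≤ ∣ T ∣)

Is2Packing : ∀ {n m} → LinearSystem n m → Subset m → Set
Is2Packing {n} {m} S R =
  ∀ (a b c : Fin m) → a ∈ R → b ∈ R → c ∈ R → a ≢ b → a ≢ c → b ≢ c →
  ¬ (∃ λ (p : Fin n) → p ∈ line S a × p ∈ line S b × p ∈ line S c)

IsNu2 : ∀ {n m} → LinearSystem n m → ℕ → Set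
IsNu2 {n} {m} S k =
  (Σ (Subset m) λ R → Is2Packing S R × ∣ R ∣ ≡ k) ×
  (∀ (R : Subset m) → Is2Packing S R → ∣ R ∣ ≤ k)

-- The lines of a maximum 2-packing are k ≤ |L| distinct r-point lines, any two
-- sharing at most one point, so their union has at least k r − C(k,2) points and
-- |P| + |L| ≥ k (r + 1) − C(k,2).  Since k ≤ r + 1, C(k,2) ≤ ⌊k/2⌋ k ≤ ⌊k/2⌋ (r + 1),
-- which leaves ⌈k/2⌉ (r + 1) = τ (r + 1).
module Submission where

open import Defs
open import Data.Nat using (ℕ; _≤_; _+_; _*_; _∸_; suc; ⌈_/2⌉)
open import Relation.Binary.PropositionalEquality using (_≡_)

open import Data.Nat using (zero; z≤n; s≤s; ⌊_/2⌋)
open import Data.Nat.Properties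
open import Data.Nat.Combinatorics using (_C_; nC1≡n; nCk+nC[k+1]≡[n+1]C[k+1])
open import Data.Nat.Solver using (module +-*-Solver)
open import Data.Bool using (true; false)
open import Data.Vec using ([]; _∷_)
open import Data.Fin using (inject≤)
open import Data.Fin.Properties using (inject≤-injective)
open import Data.Fin.Subset using (Subset; _∩_; _∪_; ∣_∣; ⋃)
open import Data.Fin.Subset.Properties using (∣p∣≤n; ∣⊥∣≡0; ∩-zeroʳ; ∩-distribˡ-∪)
open import Data.List using (List; []; _∷_; length; tabulate)
open import Data.List.Properties using (length-tabulate)
open import Data.List.Relation.Unary.All using (All; []; _∷_)
import Data.List.Relation.Unary.All.Properties as All
open import Data.List.Relation.Unary.AllPairs using (AllPairs; []; _∷_)
import Data.List.Relation.Unary.AllPairs.Properties as AllPairs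
open import Data.Product using (_,_)
open import Function using (_∘_)
open import Relation.Binary.PropositionalEquality using (refl; sym; trans; cong; subst)

∣p∪q∣+∣p∩q∣≡∣p∣+∣q∣ : ∀ {n} (p q : Subset n) → ∣ p ∪ q ∣ + ∣ p ∩ q ∣ ≡ ∣ p ∣ + ∣ q ∣
∣p∪q∣+∣p∩q∣≡∣p∣+∣q∣ []         []         = refl
∣p∪q∣+∣p∩q∣≡∣p∣+∣q∣ (true ∷ p)  (true ∷ q)  =
  cong suc (trans (+-suc _ _) (trans (cong suc (∣p∪q∣+∣p∩q∣≡∣p∣+∣q∣ p q)) (sym (+-suc _ _))))
∣p∪q∣+∣p∩q∣≡∣p∣+∣q∣ (true ∷ p)  (false ∷ q) = cong suc (∣p∪q∣+∣p∩q∣≡∣p∣+∣q∣ p q)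
∣p∪q∣+∣p∩q∣≡∣p∣+∣q∣ (false ∷ p) (true ∷ q)  = trans (cong suc (∣p∪q∣+∣p∩q∣≡∣p∣+∣q∣ p q)) (sym (+-suc _ _))
∣p∪q∣+∣p∩q∣≡∣p∣+∣q∣ (false ∷ p) (false ∷ q) = ∣p∪q∣+∣p∩q∣≡∣p∣+∣q∣ p q

∣p∪q∣≤∣p∣+∣q∣ : ∀ {n} (p q : Subset n) → ∣ p ∪ q ∣ ≤ ∣ p ∣ + ∣ q ∣
∣p∪q∣≤∣p∣+∣q∣ p q = ≤-trans (m≤m+n ∣ p ∪ q ∣ ∣ p ∩ q ∣) (≤-reflexive (∣p∪q∣+∣p∩q∣≡∣p∣+∣q∣ p q))

∣p∩[q∪r]∣≤∣p∩q∣+∣p∩r∣ : ∀ {n} (p q r : Subset n) → ∣ p ∩ (q ∪ r) ∣ ≤ ∣ p ∩ q ∣ + ∣ p ∩ r ∣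
∣p∩[q∪r]∣≤∣p∩q∣+∣p∩r∣ p q r =
  subst (λ s → ∣ s ∣ ≤ ∣ p ∩ q ∣ + ∣ p ∩ r ∣) (sym (∩-distribˡ-∪ p q r)) (∣p∪q∣≤∣p∣+∣q∣ (p ∩ q) (p ∩ r))

∣p∩⋃qs∣≤length : ∀ {n} (p : Subset n) {qs : List (Subset n)} →
                 All (λ q → ∣ p ∩ q ∣ ≤ 1) qs → ∣ p ∩ ⋃ qs ∣ ≤ length qs
∣p∩⋃qs∣≤length {n} p []                 = ≤-reflexive (trans (cong ∣_∣ (∩-zeroʳ p)) (∣⊥∣≡0 n))
∣p∩⋃qs∣≤length     p {q ∷ qs} (pq≤1 ∷ pqs≤1) =
  ≤-trans (∣p∩[q∪r]∣≤∣p∩q∣+∣p∩r∣ p q (⋃ qs)) (+-mono-≤ pq≤1 (∣p∩⋃qs∣≤length p pqs≤1))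

[1+n]C2≡n+nC2 : ∀ n → suc n C 2 ≡ n + n C 2
[1+n]C2≡n+nC2 n = trans (sym (nCk+nC[k+1]≡[n+1]C[k+1] n 1)) (cong (_+ n C 2) (nC1≡n n))

length*r≤∣⋃∣+lengthC2 : ∀ {n} r {ps : List (Subset n)} →
                        All (λ p → ∣ p ∣ ≡ r) ps → AllPairs (λ p q → ∣ p ∩ q ∣ ≤ 1) ps →
                        length ps * r ≤ ∣ ⋃ ps ∣ + length ps C 2
length*r≤∣⋃∣+lengthC2 r []                      _                 = z≤n
length*r≤∣⋃∣+lengthC2 r {p ∷ ps} (∣p∣≡r ∷ uniform) (p-meets ∷ pairs) = begin
  r + j * r                       ≤⟨ +-monoʳ-≤ r (length*r≤∣⋃∣+lengthC2 r uniform pairs) ⟩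
  r + (∣ U ∣ + j C 2)             ≡⟨ sym (+-assoc r ∣ U ∣ (j C 2)) ⟩
  (r + ∣ U ∣) + j C 2             ≡⟨ cong (λ x → (x + ∣ U ∣) + j C 2) (sym ∣p∣≡r) ⟩
  (∣ p ∣ + ∣ U ∣) + j C 2         ≡⟨ cong (_+ j C 2) (sym (∣p∪q∣+∣p∩q∣≡∣p∣+∣q∣ p U)) ⟩
  (∣ p ∪ U ∣ + ∣ p ∩ U ∣) + j C 2 ≤⟨ +-monoˡ-≤ (j C 2) (+-monoʳ-≤ ∣ p ∪ U ∣ (∣p∩⋃qs∣≤length p p-meets)) ⟩
  (∣ p ∪ U ∣ + j) + j C 2         ≡⟨ +-assoc ∣ p ∪ U ∣ j (j C 2) ⟩
  ∣ p ∪ U ∣ + (j + j C 2)         ≡⟨ cong (∣ p ∪ U ∣ +_) (sym ([1+n]C2≡n+nC2 j)) ⟩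
  ∣ p ∪ U ∣ + suc j C 2           ∎
  where
    open ≤-Reasoning
    j = length ps
    U = ⋃ ps

n≤1+⌊n/2⌋*2 : ∀ n → n ≤ suc (⌊ n /2⌋ * 2)
n≤1+⌊n/2⌋*2 zero          = z≤n
n≤1+⌊n/2⌋*2 (suc zero)    = ≤-refl
n≤1+⌊n/2⌋*2 (suc (suc n)) = s≤s (s≤s (n≤1+⌊n/2⌋*2 n))

nC2≤⌊n/2⌋*n : ∀ n → n C 2 ≤ ⌊ n /2⌋ * n
nC2≤⌊n/2⌋*n zero          = z≤n
nC2≤⌊n/2⌋*n (suc zero)    = z≤n
nC2≤⌊n/2⌋*n (suc (suc n)) = begin
  suc (suc n) C 2           ≡⟨ trans ([1+n]C2≡n+nC2 (suc n)) (cong (suc n +_) ([1+n]C2≡n+nC2 n)) ⟩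
  suc n + (n + n C 2)       ≤⟨ +-monoʳ-≤ (suc n) (+-monoʳ-≤ n (nC2≤⌊n/2⌋*n n)) ⟩
  suc n + (n + h * n)       ≤⟨ +-monoʳ-≤ (suc n) (+-monoˡ-≤ (h * n) (n≤1+⌊n/2⌋*2 n)) ⟩
  suc n + (suc (h * 2) + h * n) ≡⟨ regroup n h ⟩
  suc h * suc (suc n)           ∎
  where
    open ≤-Reasoning
    h = ⌊ n /2⌋
    open +-*-Solver
    regroup : ∀ a b → suc a + (suc (b * 2) + b * a) ≡ suc b * suc (suc a)
    regroup = solve 2 (λ a b → (con 1 :+ a) :+ ((con 1 :+ b :* con 2) :+ b :* a)
                             := (con 1 :+ b) :* (con 2 :+ a)) refl

⌈n/2⌉*m+nC2≤n*m : ∀ {n m} → n ≤ m → ⌈ n /2⌉ * m + n C 2 ≤ n * m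
⌈n/2⌉*m+nC2≤n*m {n} {m} n≤m = begin
  ⌈ n /2⌉ * m + n C 2         ≤⟨ +-monoʳ-≤ (⌈ n /2⌉ * m) (≤-trans (nC2≤⌊n/2⌋*n n) (*-monoʳ-≤ ⌊ n /2⌋ n≤m)) ⟩
  ⌈ n /2⌉ * m + ⌊ n /2⌋ * m   ≡⟨ sym (*-distribʳ-+ m ⌈ n /2⌉ ⌊ n /2⌋) ⟩
  (⌈ n /2⌉ + ⌊ n /2⌋) * m     ≡⟨ cong (_* m) (trans (+-comm ⌈ n /2⌉ ⌊ n /2⌋) (⌊n/2⌋+⌈n/2⌉≡n n)) ⟩
  n * m                       ∎
  where open ≤-Reasoning

lines*r≤points+C2 : ∀ {n m r} (S : LinearSystem n m) → Uniform S r →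
                    ∀ {k} → k ≤ m → k * r ≤ n + k C 2
lines*r≤points+C2 {n} {r = r} S uniform {k} k≤m = begin
  k * r                          ≡⟨ cong (_* r) (sym (length-tabulate g)) ⟩
  length gs * r                  ≤⟨ length*r≤∣⋃∣+lengthC2 r (All.tabulate⁺ (λ _ → uniform _)) pairwise ⟩
  ∣ ⋃ gs ∣ + length gs C 2       ≡⟨ cong (λ j → ∣ ⋃ gs ∣ + j C 2) (length-tabulate g) ⟩
  ∣ ⋃ gs ∣ + k C 2               ≤⟨ +-monoˡ-≤ (k C 2) (∣p∣≤n (⋃ gs)) ⟩
  n + k C 2                      ∎
  where
    open ≤-Reasoning
    g = line S ∘ (λ i → inject≤ i k≤m)
    gs = tabulate g
    pairwise : AllPairs (λ p q → ∣ p ∩ q ∣ ≤ 1) gs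
    pairwise = AllPairs.tabulate⁺ (λ i≢j → linear S _ _ (i≢j ∘ inject≤-injective k≤m k≤m _ _))

corollary2p6 : ∀ (n m r : ℕ) (S : LinearSystem n m) (t k : ℕ) →
    Uniform S r → IsTau S t → IsNu2 S k →
    k ∸ 1 ≤ r → t ≡ ⌈ k /2⌉ →
    t * suc r ≤ n + m
corollary2p6 n m r S t k uniform _ ((R , _ , ∣R∣≡k) , _) k∸1≤r refl =
  +-cancelʳ-≤ (k C 2) (⌈ k /2⌉ * suc r) (n + m) (begin
    ⌈ k /2⌉ * suc r + k C 2   ≤⟨ ⌈n/2⌉*m+nC2≤n*m k≤1+r ⟩
    k * suc r                 ≡⟨ *-suc k r ⟩
    k + k * r                 ≤⟨ +-mono-≤ k≤m (lines*r≤points+C2 S uniform k≤m) ⟩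
    m + (n + k C 2)           ≡⟨ trans (sym (+-assoc m n (k C 2))) (cong (_+ k C 2) (+-comm m n)) ⟩
    n + m + k C 2             ∎)
  where
    open ≤-Reasoning
    k≤m : k ≤ m
    k≤m = subst (_≤ m) ∣R∣≡k (∣p∣≤n R)
    k≤1+r : k ≤ suc r
    k≤1+r = ≤-trans (m≤n+m∸n k 1) (s≤s k∸1≤r)
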